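{- In the setting below, with $T'_R=\inf\{t:|V_R\cap X_t|\ge R-L\}$ and $T_S=\inf\{t:|S_t|\ge R-L\}$, it holds that $T'_R\ge T_S$.
   Context: $K_{L,R}$ is the complete bipartite graph with partitions $V_L$ ($|V_L|=L$), $V_R$ ($|V_R|=R$), edges all $\{v,u\}$ with $v\in V_L,u\in V_R$; $n=L+R$. Bit strings are identified with vertex sets; $f(X)=|X|_1+(n+1)u(X)$, $|X|_1$ the number of ones and $u(X)$ the number of uncovered edges. The Balanced (1+1) EA on $K_{L,R}$: in each iteration, with probability $1/2$ a standard mutation: choose $A\subseteq V$ containing each vertex independently with probability $1/n$ and let $Y$ be $X$ with the bits of $A$ flipped; otherwise a balanced flip: pick $v\in V$ uniformly at random, let $N_v$ be the neighbours $u$ of $v$ with $x_u\ne x_v$; if $N_v=\emptyset$ the iteration ends with $X$ unchanged, otherwise pick $u\in N_v$ uniformly and let $Y$ be $X$ with bits of $u,v$ flipped; then set $X\gets Y$ if $f(Y)\le f(X)$. $X_t$ is the state after $t$ iterations, $R_t=V_R\cap X_t$. The process $S_t\subseteq V_R$: $S_0=R_0$; if iteration $t+1$ is a standard mutation with chosen set $A$ (whether or not accepted), $S_{t+1}=S_t\cup(V_R\cap A)$; if it is a balanced flip with initial vertex $v$, $S_{t+1}=S_t\setminus\{v\}$. -}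

module Defs where

open import Data.Nat using (ℕ; zero; suc; _+_; _*_; _≤ᵇ_)
open import Data.Bool using (Bool; true; false; if_then_else_; not; _∧_; _∨_; _xor_)
open import Data.Fin as Fin using (Fin)
open import Data.Sum using (_⊎_; inj₁; inj₂)
open import Data.Product using (_×_)
open import Data.Unit using (⊤)
open import Data.Empty using (⊥)
open import Function using (_∘_)
open import Relation.Nullary using (¬_)
open import Relation.Nullary.Decidable using (⌊_⌋)
open import Relation.Binary.PropositionalEquality using (_≡_; _≢_)

count : ∀ {m} → (Fin m → Bool) → ℕ
count {zero}  p = 0
count {suc m} p = (if p Fin.zero then 1 else 0) + count (p ∘ Fin.suc)

sumFin : ∀ {m} → (Fin m → ℕ) → ℕ
sumFin {zero}  g = 0
sumFin {suc m} g = g Fin.zero + sumFin (g ∘ Fin.suc)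

-- Vertices of K_{L,R}: inj₁ = V_L, inj₂ = V_R
Vertex : ℕ → ℕ → Set
Vertex L R = Fin L ⊎ Fin R

Config : ℕ → ℕ → Set
Config L R = Vertex L R → Bool

_≡ᵛ_ : ∀ {L R} → Vertex L R → Vertex L R → Bool
inj₁ i ≡ᵛ inj₁ j = ⌊ i Fin.≟ j ⌋
inj₂ i ≡ᵛ inj₂ j = ⌊ i Fin.≟ j ⌋
inj₁ _ ≡ᵛ inj₂ _ = false
inj₂ _ ≡ᵛ inj₁ _ = false

Adj : ∀ {L R} → Vertex L R → Vertex L R → Set
Adj (inj₁ _) (inj₂ _) = ⊤
Adj (inj₂ _) (inj₁ _) = ⊤
Adj (inj₁ _) (inj₁ _) = ⊥
Adj (inj₂ _) (inj₂ _) = ⊥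

InN : ∀ {L R} → Config L R → Vertex L R → Vertex L R → Set
InN X v u = Adj v u × (X u ≢ X v)

ones : ∀ {L R} → Config L R → ℕ
ones X = count (X ∘ inj₁) + count (X ∘ inj₂)

uncovered : ∀ {L R} → Config L R → ℕ
uncovered X = sumFin (λ i → count (λ j → not (X (inj₁ i)) ∧ not (X (inj₂ j))))

fitness : ∀ {L R} → Config L R → ℕ
fitness {L} {R} X = ones X + (L + R + 1) * uncovered X

-- Random choices made in one iteration
data Choice (L R : ℕ) : Set where
  std     : (Vertex L R → Bool) → Choice L R            -- standard mutation with set A
  balNone : Vertex L R → Choice L R                     -- balanced flip, initial v, N_v = ∅
  balPair : Vertex L R → Vertex L R → Choice L R        -- balanced flip, initial v, partner u ∈ N_v

-- the choices which are possible (positive probability) in state X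
Valid : ∀ {L R} → Config L R → Choice L R → Set
Valid X (std A)       = ⊤
Valid X (balNone v)   = ∀ u → ¬ InN X v u
Valid X (balPair v u) = InN X v u

offspring : ∀ {L R} → Config L R → Choice L R → Config L R
offspring X (std A)       = λ w → X w xor A w
offspring X (balNone v)   = X
offspring X (balPair v u) = λ w → X w xor ((w ≡ᵛ u) ∨ (w ≡ᵛ v))

step : ∀ {L R} → Config L R → Choice L R → Config L R
step X c = if fitness (offspring X c) ≤ᵇ fitness X then offspring X c else X

run : ∀ {L R} → Config L R → (ℕ → Choice L R) → ℕ → Config L R
run X0 cs zero    = X0
run X0 cs (suc t) = step (run X0 cs t) (cs t)

sStep : ∀ {L R} → (Fin R → Bool) → Choice L R → (Fin R → Bool)
sStep S (std A)       = λ j → S j ∨ A (inj₂ j)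
sStep S (balNone v)   = λ j → S j ∧ not (inj₂ j ≡ᵛ v)
sStep S (balPair v u) = λ j → S j ∧ not (inj₂ j ≡ᵛ v)

runS : ∀ {L R} → Config L R → (ℕ → Choice L R) → ℕ → (Fin R → Bool)
runS X0 cs zero    = X0 ∘ inj₂
runS X0 cs (suc t) = sStep (runS X0 cs t) (cs t)

sizeR : ∀ {L R} → Config L R → ℕ
sizeR X = count (X ∘ inj₂)

-- While |R_t| < R − L, the invariant R_t ⊆ S_t holds unless X_t ⊇ V_L. A standard mutation adds to S
-- every right vertex it could add to R. A balanced flip that moves a vertex from V_L to V_R raises the
-- number of uncovered edges and is rejected; one starting at j ∈ R_t either removes j from X (and is
-- accepted) or has N_j = ∅, which means V_L ⊆ X_t. Once V_L ⊆ X_t the fitness is L + |R_t| < R, while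
-- every configuration missing a left vertex has fitness at least R, so from then on V_L stays covered
-- and |R_t| never increases. Hence |R_t| first reaches R − L at a time when R_t ⊆ S_t.
module Submission where

open import Defs
open import Data.Nat using (ℕ; zero; suc; _+_; _*_; _∸_; _≤_; _<_; z≤n; s≤s; _≤ᵇ_; _≤?_; NonZero; >-nonZero)
open import Data.Nat.Properties
open import Data.Bool using (Bool; true; false; if_then_else_; not; _∧_; _∨_; _xor_; T)
open import Data.Bool.Properties using (not-involutive; ∧-identityʳ; ∨-identityʳ; ∨-zeroʳ; xor-comm; xor-identityʳ)
open import Data.Fin as Fin using (Fin)
import Data.Fin.Properties as Fin
open import Data.Product using (∃-syntax; _×_; _,_)
open import Data.Sum using (_⊎_; inj₁; inj₂)
open import Data.Unit using (tt)
open import Function using (_∘_; id)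
open import Relation.Nullary using (yes; no; contradiction)
open import Relation.Nullary.Decidable using (⌊_⌋)
open import Relation.Binary.PropositionalEquality

_⊆_ : ∀ {m} → (Fin m → Bool) → (Fin m → Bool) → Set
p ⊆ q = ∀ k → p k ≡ true → q k ≡ true

⊆-trans : ∀ {m} {p q r : Fin m → Bool} → p ⊆ q → q ⊆ r → p ⊆ r
⊆-trans p⊆q q⊆r k = q⊆r k ∘ p⊆q k

⊆-∨ : ∀ {m} {p q : Fin m → Bool} (a : Fin m → Bool) → p ⊆ q → p ⊆ (λ k → q k ∨ a k)
⊆-∨ a p⊆q k pk rewrite p⊆q k pk = refl

⊆-xor-∨ : ∀ {m} {p q : Fin m → Bool} (a : Fin m → Bool) → p ⊆ q → (λ k → p k xor a k) ⊆ (λ k → q k ∨ a k)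
⊆-xor-∨ {p = p} {q} a p⊆q k with p k in pk | a k
... | true  | false = λ _ → trans (∨-identityʳ (q k)) (p⊆q k pk)
... | false | true  = λ _ → ∨-zeroʳ (q k)
... | true  | true  = λ ()
... | false | false = λ ()

⊆-∧-true : ∀ {m} {p q : Fin m → Bool} → p ⊆ q → p ⊆ (λ k → q k ∧ true)
⊆-∧-true {q = q} p⊆q k pk = trans (∧-identityʳ (q k)) (p⊆q k pk)

⊆-remove : ∀ {m} {p q : Fin m → Bool} {i} → p ⊆ q → p i ≡ false → p ⊆ (λ k → q k ∧ not ⌊ k Fin.≟ i ⌋)
⊆-remove {i = i} p⊆q pi k pk with k Fin.≟ i
... | yes refl = contradiction (trans (sym pk) pi) λ ()
... | no _     = ⊆-∧-true p⊆q k pk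

indicator : Bool → ℕ
indicator b = if b then 1 else 0

count-cong : ∀ {m} {p q : Fin m → Bool} → (∀ k → p k ≡ q k) → count p ≡ count q
count-cong {zero}  eq = refl
count-cong {suc m} eq = cong₂ _+_ (cong indicator (eq Fin.zero)) (count-cong (eq ∘ Fin.suc))

count-false : ∀ {m} → count {m} (λ _ → false) ≡ 0
count-false {zero}  = refl
count-false {suc m} = count-false {m}

count-complement : ∀ {m} (p : Fin m → Bool) → count p + count (not ∘ p) ≡ m
count-complement {zero}  p = refl
count-complement {suc m} p = head (p Fin.zero) (count-complement (p ∘ Fin.suc))
  where
  head : ∀ b {x y} → x + y ≡ m → (indicator b + x) + (indicator (not b) + y) ≡ suc m
  head true  eq = cong suc eq
  head false eq = trans (+-suc _ _) (cong suc eq)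

count-mono : ∀ {m} {p q : Fin m → Bool} → p ⊆ q → count p ≤ count q
count-mono {zero}  p⊆q = z≤n
count-mono {suc m} {p} {q} p⊆q =
  +-mono-≤ (head (p Fin.zero) (q Fin.zero) (p⊆q Fin.zero)) (count-mono (p⊆q ∘ Fin.suc))
  where
  head : ∀ a b → (a ≡ true → b ≡ true) → indicator a ≤ indicator b
  head false b a⇒b = z≤n
  head true  b a⇒b rewrite a⇒b refl = ≤-refl

count-pos : ∀ {m} {p : Fin m → Bool} (i : Fin m) → p i ≡ true → 1 ≤ count p
count-pos         Fin.zero    pi rewrite pi = s≤s z≤n
count-pos {p = p} (Fin.suc i) pi = ≤-trans (count-pos i pi) (m≤n+m _ (indicator (p Fin.zero)))

sumFin-count-∧ : ∀ {m k} (p : Fin m → Bool) (q : Fin k → Bool) →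
  sumFin (λ i → count (λ j → p i ∧ q j)) ≡ count p * count q
sumFin-count-∧ {zero}  p q = refl
sumFin-count-∧ {suc m} {k} p q =
  trans (cong₂ _+_ (row (p Fin.zero)) (sumFin-count-∧ (p ∘ Fin.suc) q))
        (sym (*-distribʳ-+ (count q) (indicator (p Fin.zero)) _))
  where
  row : ∀ a → count (λ j → a ∧ q j) ≡ indicator a * count q
  row true  = sym (+-identityʳ _)
  row false = count-false {k}

record FlippedAt {m} (p q : Fin m → Bool) (i : Fin m) : Set where
  field
    at      : q i ≡ not (p i)
    outside : ∀ k → k ≢ i → q k ≡ p k

flippedAt-sym : ∀ {m} {p q : Fin m → Bool} {i} → FlippedAt p q i → FlippedAt q p i
flippedAt-sym {p = p} {q} {i} f = record
  { at      = trans (sym (not-involutive (p i))) (cong not (sym at))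
  ; outside = λ k k≢i → sym (outside k k≢i)
  }
  where open FlippedAt f

flippedAt-not : ∀ {m} {p q : Fin m → Bool} {i} → FlippedAt p q i → FlippedAt (not ∘ p) (not ∘ q) i
flippedAt-not f = record { at = cong not at ; outside = λ k k≢i → cong not (outside k k≢i) }
  where open FlippedAt f

count-flippedAt : ∀ {m} {p q : Fin m → Bool} {i} → FlippedAt p q i → p i ≡ true → count p ≡ suc (count q)
count-flippedAt {suc m} {p} {q} {Fin.zero} f pi =
  begin
    indicator (p Fin.zero) + count (p ∘ Fin.suc)   ≡⟨ cong (λ b → indicator b + count (p ∘ Fin.suc)) pi ⟩
    suc (count (p ∘ Fin.suc))                       ≡⟨ cong suc (count-cong λ k → sym (outside (Fin.suc k) λ ())) ⟩
    suc (count (q ∘ Fin.suc))                       ≡⟨ cong (λ b → suc (indicator b + count (q ∘ Fin.suc))) (sym qi) ⟩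
    suc (indicator (q Fin.zero) + count (q ∘ Fin.suc)) ∎
  where
  open ≡-Reasoning
  open FlippedAt f
  qi : q Fin.zero ≡ false
  qi = trans at (cong not pi)
count-flippedAt {suc m} {p} {q} {Fin.suc i} f pi =
  trans (cong₂ _+_ (cong indicator (sym (outside Fin.zero λ ()))) (count-flippedAt tail pi)) (+-suc _ _)
  where
  open FlippedAt f
  tail : FlippedAt (p ∘ Fin.suc) (q ∘ Fin.suc) i
  tail = record { at = at ; outside = λ k k≢i → outside (Fin.suc k) (k≢i ∘ Fin.suc-injective) }

flippedAt-⊆ : ∀ {m} {p q : Fin m → Bool} {i} → FlippedAt p q i → p i ≡ true → q ⊆ p
flippedAt-⊆ {i = i} f pi k qk with k Fin.≟ i
... | yes refl = contradiction (trans (sym qk) (trans (FlippedAt.at f) (cong not pi))) λ ()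
... | no k≢i = trans (sym (FlippedAt.outside f k k≢i)) qk

flippedAt-xor : ∀ {m} (p : Fin m → Bool) (i : Fin m) (e : Fin m → Bool) →
  (∀ k → e k ≡ ⌊ k Fin.≟ i ⌋) → FlippedAt p (λ k → p k xor e k) i
flippedAt-xor p i e e≗ = record { at = at ; outside = outside }
  where
  at : p i xor e i ≡ not (p i)
  at rewrite e≗ i with i Fin.≟ i
  ... | yes _   = xor-comm (p i) true
  ... | no i≢i = contradiction refl i≢i
  outside : ∀ k → k ≢ i → p k xor e k ≡ p k
  outside k k≢i rewrite e≗ k with k Fin.≟ i
  ... | yes k≡i = contradiction k≡i k≢i
  ... | no _    = xor-identityʳ (p k)

m<n⇒m*[1+n]<[1+m]*n : ∀ {a b} → a < b → a * suc b < suc a * b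
m<n⇒m*[1+n]<[1+m]*n {a} {b} a<b = subst₂ _<_ (sym (*-suc a b)) refl (+-monoˡ-< (a * b) a<b)

module _ {L R : ℕ} where

  instance
    weight-nonZero : NonZero (L + R + 1)
    weight-nonZero = >-nonZero (m≤n+m 1 (L + R))

  CoversLeft : Config L R → Set
  CoversLeft X = ∀ i → X (inj₁ i) ≡ true

  uncovered≡missing*missing : (X : Config L R) →
    uncovered X ≡ count (not ∘ X ∘ inj₁) * count (not ∘ X ∘ inj₂)
  uncovered≡missing*missing X = sumFin-count-∧ (not ∘ X ∘ inj₁) (not ∘ X ∘ inj₂)

  fitness-< : (X Y : Config L R) → ones X ≡ ones Y → uncovered X < uncovered Y → fitness X < fitness Y
  fitness-< X Y same-ones fewer = +-mono-≤-< (≤-reflexive same-ones) (*-monoʳ-< (L + R + 1) fewer)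

  fitness-coversLeft : (X : Config L R) → CoversLeft X → fitness X ≡ L + sizeR X
  fitness-coversLeft X covers = begin
    count (X ∘ inj₁) + sizeR X + (L + R + 1) * uncovered X
      ≡⟨ cong₂ (λ a u → a + sizeR X + (L + R + 1) * u) ones-left uncovered-0 ⟩
    L + sizeR X + (L + R + 1) * 0
      ≡⟨ cong (L + sizeR X +_) (*-zeroʳ (L + R + 1)) ⟩
    L + sizeR X + 0
      ≡⟨ +-identityʳ _ ⟩
    L + sizeR X ∎
    where
    open ≡-Reasoning
    missing-left : count (not ∘ X ∘ inj₁) ≡ 0
    missing-left = trans (count-cong (λ i → cong not (covers i))) (count-false {L})
    ones-left : count (X ∘ inj₁) ≡ L
    ones-left = trans (sym (+-identityʳ _))
                (trans (cong (count (X ∘ inj₁) +_) (sym missing-left)) (count-complement (X ∘ inj₁)))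
    uncovered-0 : uncovered X ≡ 0
    uncovered-0 = trans (uncovered≡missing*missing X) (cong (_* count (not ∘ X ∘ inj₂)) missing-left)

  -- A left vertex outside X leaves every edge to a right vertex outside X uncovered.
  R≤fitness : (X : Config L R) (i : Fin L) → X (inj₁ i) ≡ false → R ≤ fitness X
  R≤fitness X i Xi = begin
    R                                                 ≡⟨ sym (count-complement (X ∘ inj₂)) ⟩
    sizeR X + missing-right                           ≤⟨ +-monoʳ-≤ (sizeR X) missing-right≤ ⟩
    sizeR X + (L + R + 1) * uncovered X               ≤⟨ +-monoˡ-≤ _ (m≤n+m (sizeR X) (count (X ∘ inj₁))) ⟩
    count (X ∘ inj₁) + sizeR X + (L + R + 1) * uncovered X ∎
    where
    open ≤-Reasoning
    missing-right = count (not ∘ X ∘ inj₂)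
    instance
      missing-left-nonZero : NonZero (count (not ∘ X ∘ inj₁))
      missing-left-nonZero = >-nonZero (count-pos i (cong not Xi))
    missing-right≤ : missing-right ≤ (L + R + 1) * uncovered X
    missing-right≤ = ≤-trans (subst (missing-right ≤_) (sym (uncovered≡missing*missing X))
                                    (m≤n*m missing-right (count (not ∘ X ∘ inj₁))))
                             (m≤n*m (uncovered X) (L + R + 1))

  coversLeft-absorbing : (X Y : Config L R) → CoversLeft X → L + sizeR X < R → fitness Y ≤ fitness X
    → CoversLeft Y × sizeR Y ≤ sizeR X
  coversLeft-absorbing X Y covers-X small fY≤fX =
    covers-Y , +-cancelˡ-≤ L _ _ (subst₂ _≤_ (fitness-coversLeft Y covers-Y) (fitness-coversLeft X covers-X) fY≤fX)
    where
    covers-Y : CoversLeft Y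
    covers-Y i with Y (inj₁ i) in Yi
    ... | true  = refl
    ... | false = contradiction (≤-trans (R≤fitness Y i Yi) fY≤fX)
                                (<⇒≱ (subst (_< R) (sym (fitness-coversLeft X covers-X)) small))

  record Swapped (X Y : Config L R) (i : Fin L) (j : Fin R) : Set where
    constructor swapped
    field
      left  : FlippedAt (X ∘ inj₁) (Y ∘ inj₁) i
      right : FlippedAt (X ∘ inj₂) (Y ∘ inj₂) j

  swapped-sym : ∀ {X Y i j} → Swapped X Y i j → Swapped Y X i j
  swapped-sym (swapped left right) = swapped (flippedAt-sym left) (flippedAt-sym right)

  balPair-left-right-swapped : (X : Config L R) (i : Fin L) (j : Fin R) →
    Swapped X (offspring X (balPair (inj₁ i) (inj₂ j))) i j
  balPair-left-right-swapped X i j =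
    swapped (flippedAt-xor (X ∘ inj₁) i _ (λ _ → refl)) (flippedAt-xor (X ∘ inj₂) j _ (λ _ → ∨-identityʳ _))

  balPair-right-left-swapped : (X : Config L R) (i : Fin L) (j : Fin R) →
    Swapped X (offspring X (balPair (inj₂ j) (inj₁ i))) i j
  balPair-right-left-swapped X i j =
    swapped (flippedAt-xor (X ∘ inj₁) i _ (λ _ → ∨-identityʳ _)) (flippedAt-xor (X ∘ inj₂) j _ (λ _ → refl))

  -- With a = |V_L ∖ X| and b = |V_R ∖ Y| the uncovered edges go from a (b + 1) to (a + 1) b,
  -- and a < L ≤ b as long as |R_X| < R − L.
  fitness-<-shiftRight : (X Y : Config L R) (i : Fin L) (j : Fin R) → Swapped X Y i j →
    X (inj₁ i) ≡ true → X (inj₂ j) ≡ false → L + sizeR X < R → fitness X < fitness Y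
  fitness-<-shiftRight X Y i j (swapped left right) Xi Xj small =
    fitness-< X Y same-ones (subst₂ _<_ (sym uncovered-X) (sym uncovered-Y) (m<n⇒m*[1+n]<[1+m]*n (<-≤-trans a<L L≤b)))
    where
    a = count (not ∘ X ∘ inj₁)
    b = count (not ∘ Y ∘ inj₂)
    Yj : Y (inj₂ j) ≡ true
    Yj = trans (FlippedAt.at right) (cong not Xj)
    ones-left : count (X ∘ inj₁) ≡ suc (count (Y ∘ inj₁))
    ones-left = count-flippedAt left Xi
    ones-right : sizeR Y ≡ suc (sizeR X)
    ones-right = count-flippedAt (flippedAt-sym right) Yj
    missing-left : count (not ∘ Y ∘ inj₁) ≡ suc a
    missing-left = count-flippedAt (flippedAt-sym (flippedAt-not left))
                                   (cong not (trans (FlippedAt.at left) (cong not Xi)))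
    missing-right : count (not ∘ X ∘ inj₂) ≡ suc b
    missing-right = count-flippedAt (flippedAt-not right) (cong not Xj)
    same-ones : ones X ≡ ones Y
    same-ones = trans (cong (_+ sizeR X) ones-left)
                      (trans (sym (+-suc _ (sizeR X))) (cong (count (Y ∘ inj₁) +_) (sym ones-right)))
    a<L : a < L
    a<L = subst (suc a ≤_) (trans (cong (_+ a) (sym ones-left)) (count-complement (X ∘ inj₁)))
                (s≤s (m≤n+m a (count (Y ∘ inj₁))))
    L≤b : L ≤ b
    L≤b = ≤-pred (+-cancelˡ-< (sizeR X) L (suc b)
            (subst₂ _<_ (+-comm L (sizeR X))
                        (sym (trans (cong (sizeR X +_) (sym missing-right)) (count-complement (X ∘ inj₂))))
                        small))
    uncovered-X : uncovered X ≡ a * suc b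
    uncovered-X = trans (uncovered≡missing*missing X) (cong (a *_) missing-right)
    uncovered-Y : uncovered Y ≡ suc a * b
    uncovered-Y = trans (uncovered≡missing*missing Y) (cong (_* b) missing-left)

  step-either : (P : Config L R → Set) (X : Config L R) (c : Choice L R) → P (offspring X c) → P X → P (step X c)
  step-either P X c accepted rejected with fitness (offspring X c) ≤ᵇ fitness X
  ... | true  = accepted
  ... | false = rejected

  step-accepts : (X : Config L R) (c : Choice L R) → fitness (offspring X c) ≤ fitness X → step X c ≡ offspring X c
  step-accepts X c le with fitness (offspring X c) ≤ᵇ fitness X in eq
  ... | true  = refl
  ... | false = contradiction (≤⇒≤ᵇ le) (subst T eq)

  step-rejects : (X : Config L R) (c : Choice L R) → fitness X < fitness (offspring X c) → step X c ≡ X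
  step-rejects X c lt with fitness (offspring X c) ≤ᵇ fitness X in eq
  ... | true  = contradiction (≤ᵇ⇒≤ _ _ (subst T (sym eq) tt)) (<⇒≱ lt)
  ... | false = refl

  step-fitness-≤ : (X : Config L R) (c : Choice L R) → fitness (step X c) ≤ fitness X
  step-fitness-≤ X c with fitness (offspring X c) ≤ᵇ fitness X in eq
  ... | true  = ≤ᵇ⇒≤ _ _ (subst T (sym eq) tt)
  ... | false = ≤-refl

  _⊆ᴿ_ : Config L R → (Fin R → Bool) → Set
  X ⊆ᴿ S = (X ∘ inj₂) ⊆ S

  balNone-right-⊆ : (X : Config L R) (S : Fin R → Bool) (j : Fin R) → Valid X (balNone (inj₂ j)) → X ⊆ᴿ S
    → step X (balNone (inj₂ j)) ⊆ᴿ sStep {L} S (balNone (inj₂ j)) ⊎ CoversLeft X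
  balNone-right-⊆ X S j isolated sub with X (inj₂ j) in Xj
  ... | false = inj₁ (step-either (_⊆ᴿ _) X (balNone (inj₂ j)) (⊆-remove sub Xj) (⊆-remove sub Xj))
  ... | true  = inj₂ covers
    where
    covers : CoversLeft X
    covers i with X (inj₁ i) in Xi
    ... | true  = refl
    ... | false = contradiction (tt , λ Xi≡true → contradiction (trans (sym Xi) Xi≡true) λ ()) (isolated (inj₁ i))

  balPair-left-right-⊆ : (X : Config L R) (S : Fin R → Bool) (i : Fin L) (j : Fin R) → X (inj₂ j) ≢ X (inj₁ i)
    → L + sizeR X < R → X ⊆ᴿ S → step X (balPair (inj₁ i) (inj₂ j)) ⊆ᴿ sStep S (balPair (inj₁ i) (inj₂ j))
  balPair-left-right-⊆ X S i j differ small sub with X (inj₁ i) in Xi | X (inj₂ j) in Xj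
  ... | true  | true  = contradiction refl differ
  ... | false | false = contradiction refl differ
  ... | true  | false = subst (_⊆ᴿ _) (sym (step-rejects X c raises)) (⊆-∧-true sub)
    where
    c = balPair (inj₁ i) (inj₂ j)
    raises = fitness-<-shiftRight X (offspring X c) i j (balPair-left-right-swapped X i j) Xi Xj small
  ... | false | true  = step-either (_⊆ᴿ _) X c (⊆-∧-true (⊆-trans shrinks sub)) (⊆-∧-true sub)
    where
    c = balPair (inj₁ i) (inj₂ j)
    shrinks = flippedAt-⊆ (Swapped.right (balPair-left-right-swapped X i j)) Xj

  balPair-right-left-⊆ : (X : Config L R) (S : Fin R → Bool) (i : Fin L) (j : Fin R) → X (inj₁ i) ≢ X (inj₂ j)
    → L + sizeR X < R → X ⊆ᴿ S → step X (balPair (inj₂ j) (inj₁ i)) ⊆ᴿ sStep S (balPair (inj₂ j) (inj₁ i))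
  balPair-right-left-⊆ X S i j differ small sub with X (inj₁ i) in Xi | X (inj₂ j) in Xj
  ... | true  | true  = contradiction refl differ
  ... | false | false = contradiction refl differ
  ... | true  | false = subst (_⊆ᴿ _) (sym (step-rejects X c raises)) (⊆-remove sub Xj)
    where
    c = balPair (inj₂ j) (inj₁ i)
    raises = fitness-<-shiftRight X (offspring X c) i j (balPair-right-left-swapped X i j) Xi Xj small
  ... | false | true  = subst (_⊆ᴿ _) (sym (step-accepts X c (<⇒≤ lowers))) (⊆-remove (⊆-trans shrinks sub) Oj)
    where
    c = balPair (inj₂ j) (inj₁ i)
    O = offspring X c
    swap = balPair-right-left-swapped X i j
    open Swapped swap
    shrinks = flippedAt-⊆ right Xj
    Oj : O (inj₂ j) ≡ false
    Oj = trans (FlippedAt.at right) (cong not Xj)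
    Oi : O (inj₁ i) ≡ true
    Oi = trans (FlippedAt.at left) (cong not Xi)
    lowers : fitness O < fitness X
    lowers = fitness-<-shiftRight O X i j (swapped-sym swap) Oi Oj
               (≤-<-trans (+-monoʳ-≤ L (count-mono shrinks)) small)

  step-⊆ : (X : Config L R) (S : Fin R → Bool) (c : Choice L R) → Valid X c → L + sizeR X < R
    → X ⊆ᴿ S → step X c ⊆ᴿ sStep S c ⊎ CoversLeft X
  step-⊆ X S (std A) _ _ sub =
    inj₁ (step-either (_⊆ᴿ _) X (std A) (⊆-xor-∨ (A ∘ inj₂) sub) (⊆-∨ (A ∘ inj₂) sub))
  step-⊆ X S (balNone (inj₁ i)) _ _ sub =
    inj₁ (step-either (_⊆ᴿ _) X (balNone (inj₁ i)) (⊆-∧-true sub) (⊆-∧-true sub))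
  step-⊆ X S (balNone (inj₂ j)) isolated _ sub = balNone-right-⊆ X S j isolated sub
  step-⊆ X S (balPair (inj₁ _) (inj₁ _)) (() , _)
  step-⊆ X S (balPair (inj₂ _) (inj₂ _)) (() , _)
  step-⊆ X S (balPair (inj₁ i) (inj₂ j)) (_ , differ) small sub = inj₁ (balPair-left-right-⊆ X S i j differ small sub)
  step-⊆ X S (balPair (inj₂ j) (inj₁ i)) (_ , differ) small sub = inj₁ (balPair-right-left-⊆ X S i j differ small sub)

  Below : ℕ → Config L R → (Fin R → Bool) → Set
  Below K X S = sizeR X < K × (X ⊆ᴿ S ⊎ CoversLeft X)

  step-below : (X : Config L R) (S : Fin R → Bool) (c : Choice L R) → Valid X c → Below (R ∸ L) X S
    → R ∸ L ≤ count (sStep S c) ⊎ Below (R ∸ L) (step X c) (sStep S c)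
  step-below X S c valid (small , invariant) = settle (advance invariant)
    where
    small′ : L + sizeR X < R
    small′ = ≰⇒> λ R≤L+|X| → <⇒≱ small (m≤n+o⇒m∸n≤o R L R≤L+|X|)
    advance : X ⊆ᴿ S ⊎ CoversLeft X → step X c ⊆ᴿ sStep S c ⊎ CoversLeft X
    advance (inj₁ sub)    = step-⊆ X S c valid small′ sub
    advance (inj₂ covers) = inj₂ covers
    settle : step X c ⊆ᴿ sStep S c ⊎ CoversLeft X
      → R ∸ L ≤ count (sStep S c) ⊎ Below (R ∸ L) (step X c) (sStep S c)
    settle (inj₂ covers) with coversLeft-absorbing X (step X c) covers small′ (step-fitness-≤ X c)
    ... | covers′ , shrinks = inj₂ (≤-<-trans shrinks small , inj₂ covers′)
    settle (inj₁ sub) with R ∸ L ≤? sizeR (step X c)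
    ... | yes large = inj₁ (≤-trans large (count-mono sub))
    ... | no  small″ = inj₂ (≰⇒> small″ , inj₁ sub)

reached-or-below : (L R : ℕ) (X0 : Config L R) (cs : ℕ → Choice L R) → (∀ t → Valid (run X0 cs t) (cs t))
  → ∀ t → ∃[ s ] (s ≤ t × R ∸ L ≤ count (runS X0 cs s)) ⊎ Below (R ∸ L) (run X0 cs t) (runS X0 cs t)
reached-or-below L R X0 cs valid zero with R ∸ L ≤? sizeR X0
... | yes large = inj₁ (0 , z≤n , large)
... | no  small = inj₂ (≰⇒> small , inj₁ (λ _ → id))
reached-or-below L R X0 cs valid (suc t) with reached-or-below L R X0 cs valid t
... | inj₁ (s , s≤t , large) = inj₁ (s , m≤n⇒m≤1+n s≤t , large)
... | inj₂ below with step-below (run X0 cs t) (runS X0 cs t) (cs t) (valid t) below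
...   | inj₁ large  = inj₁ (suc t , ≤-refl , large)
...   | inj₂ below′ = inj₂ below′

mainTheorem16 : (L R : ℕ) (X0 : Config L R) (cs : ℕ → Choice L R)
    → (∀ t → Valid (run X0 cs t) (cs t))
    → ∀ t → R ∸ L ≤ sizeR (run X0 cs t)
    → ∃[ s ] (s ≤ t × R ∸ L ≤ count (runS X0 cs s))
mainTheorem16 L R X0 cs valid t large with reached-or-below L R X0 cs valid t
... | inj₁ reached     = reached
... | inj₂ (small , _) = contradiction large (<⇒≱ small)
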